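{- Let $p,p'$ be odd primes with $p\neq p'$, fix a choice of sign (upper or lower throughout), and let $v,w$ be variables. Define in $\mathbb{Z}[1/2][v,w]$ $$f_p(v,w):=\tfrac12\left(\pm(\pm v+w)^p+v^p\mp w^p\right),$$ $f_{pp'}(v,w):=f_{p'}(f_p(v,w),f_p(w,v))$, and $g_{pp'}(v,w):=f_{pp'}(v,w)-f_{p'p}(v,w)$. Then $g_{pp'}(v,w)\neq 0$. -}

module Defs where

open import Data.Nat using (ℕ; zero; suc)
open import Data.List using (List; []; _∷_; map)
open import Data.Rational using (ℚ; 0ℚ; 1ℚ; ½; _+_; _*_; -_)
open import Data.Sign using (Sign)

-- Dense univariate polynomials over a coefficient type A:
-- the list (a₀ ∷ a₁ ∷ …) represents a₀ + a₁ x + a₂ x² + …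
addL : {A : Set} → (A → A → A) → List A → List A → List A
addL f [] ys = ys
addL f (x ∷ xs) [] = x ∷ xs
addL f (x ∷ xs) (y ∷ ys) = f x y ∷ addL f xs ys

mulL : {A : Set} → A → (A → A → A) → (A → A → A) → List A → List A → List A
mulL z add mul [] ys = []
mulL z add mul (x ∷ xs) ys = addL add (map (mul x) ys) (z ∷ mulL z add mul xs ys)

P1 : Set
P1 = List ℚ

add1 : P1 → P1 → P1
add1 = addL _+_

mul1 : P1 → P1 → P1
mul1 = mulL 0ℚ _+_ _*_

-- ℚ[v,w] = (ℚ[w])[v]: the i-th entry of the outer list is the
-- coefficient of v^i, itself a polynomial in w.
P2 : Set
P2 = List P1

add2 : P2 → P2 → P2
add2 = addL add1

mul2 : P2 → P2 → P2
mul2 = mulL [] add1 mul1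

scale2 : ℚ → P2 → P2
scale2 c = map (map (c *_))

neg2 : P2 → P2
neg2 = scale2 (- 1ℚ)

sub2 : P2 → P2 → P2
sub2 a b = add2 a (neg2 b)

const2 : ℚ → P2
const2 c = (c ∷ []) ∷ []

pow2 : P2 → ℕ → P2
pow2 a zero = const2 1ℚ
pow2 a (suc n) = mul2 a (pow2 a n)

varV : P2
varV = [] ∷ (1ℚ ∷ []) ∷ []

varW : P2
varW = (0ℚ ∷ 1ℚ ∷ []) ∷ []

coeff1 : P1 → ℕ → ℚ
coeff1 [] j = 0ℚ
coeff1 (c ∷ cs) zero = c
coeff1 (c ∷ cs) (suc j) = coeff1 cs j

coeff2 : P2 → ℕ → ℕ → ℚ
coeff2 [] i j = 0ℚ
coeff2 (a ∷ as) zero j = coeff1 a j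
coeff2 (a ∷ as) (suc i) j = coeff2 as i j

IsZero2 : P2 → Set
IsZero2 a = ∀ i j → coeff2 a i j ≡′ 0ℚ
  where open import Relation.Binary.PropositionalEquality renaming (_≡_ to _≡′_)

-- the sign: Sign.+ is the upper choice, Sign.- the lower choice
ε : Sign → ℚ
ε Sign.+ = 1ℚ
ε Sign.- = - 1ℚ

fp : Sign → ℕ → P2 → P2 → P2
fp s p a b =
  scale2 ½ (add2 (scale2 (ε s) (pow2 (add2 (scale2 (ε s) a) b) p))
                 (sub2 (pow2 a p) (scale2 (ε s) (pow2 b p))))

fpp : Sign → ℕ → ℕ → P2
fpp s p p' = fp s p' (fp s p varV varW) (fp s p varW varV)

gpp : Sign → ℕ → ℕ → P2
gpp s p p' = sub2 (fpp s p p') (fpp s p' p)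

{-# OPTIONS --safe #-}
-- Evaluate g_{pp′} at (v, w) = (2, ∓1) and write p = 1 + 2k, p′ = 1 + 2k′. Since (±1)² = 1 and
-- p is odd, the signs collapse: f_p(2, ∓1) = 1 + 2^{2k} and f_p(∓1, 2) = ∓2^{2k}, hence
-- g_{pp′}(2, ∓1) = ½ (D(2k, p′) − D(2k′, p)) with D(a, n) = 1 + (1 + 2^a)^n + 2^{an} (doubledValue a n).
-- For a ≥ 1 and odd n ≥ 3, expanding (1 + 2^a)^n to first order gives D(a, n) = 2 + 2^a · odd,
-- so D(a, n) determines a, and D(2k, p′) = D(2k′, p) would force p = p′.
module Submission where

open import Defs
open import Data.Nat using (ℕ)
open import Data.Nat.Primality using (Prime)
open import Data.Nat.Divisibility using (_∣_)
open import Data.Sign using (Sign)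
open import Relation.Nullary using (¬_)
open import Relation.Binary.PropositionalEquality using (_≢_)

open import Data.Product using (_,_)
open import Function using (_∘_)
open import Relation.Binary.PropositionalEquality
open import Relation.Nullary using (contradiction)
open import Data.Nat.Base using (suc; s≤s; z≤n)

module _ where
  open import Data.List.Base using ([]; _∷_)
  open import Data.Product using (∃-syntax; _×_)
  open import Data.Nat.Base
  open import Data.Nat.Divisibility
  open import Data.Nat.Primality using (¬prime[1])
  open import Data.Nat.Properties
  open import Data.Nat.Tactic.RingSolver using (solve-∀; solve)

  odd⇒≡1+2k : ∀ n → ¬ 2 ∣ n → ∃[ k ] n ≡ suc (2 * k)
  odd⇒≡1+2k 0 odd = contradiction (2 ∣0) odd
  odd⇒≡1+2k 1 _ = 0 , refl
  odd⇒≡1+2k (suc (suc n)) odd with odd⇒≡1+2k n (odd ∘ ∣m∣n⇒∣m+n ∣-refl)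
  ... | k , refl = suc k , cong suc (sym (*-distribˡ-+ 2 1 k))

  odd-prime⇒≡3+2k : ∀ {p} → Prime p → ¬ 2 ∣ p → ∃[ k ] p ≡ suc (2 * suc k)
  odd-prime⇒≡3+2k {p} p-prime odd with odd⇒≡1+2k p odd
  ... | zero , refl = contradiction p-prime ¬prime[1]
  ... | suc k , p≡ = k , p≡

  [1+x]^n≡1+x*[n+x*k] : ∀ x n → ∃[ k ] (1 + x) ^ n ≡ 1 + x * (n + x * k)
  [1+x]^n≡1+x*[n+x*k] x zero = 0 , solve (x ∷ [])
  [1+x]^n≡1+x*[n+x*k] x (suc n) with [1+x]^n≡1+x*[n+x*k] x n
  ... | k , eq = n + k + x * k , (begin
    (1 + x) * (1 + x) ^ n            ≡⟨ cong ((1 + x) *_) eq ⟩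
    (1 + x) * (1 + x * (n + x * k))  ≡⟨ solve (x ∷ n ∷ k ∷ []) ⟩
    1 + x * (suc n + x * (n + k + x * k)) ∎)
    where open ≡-Reasoning

  1+[1+x]^n+x^n≡2+x*odd : ∀ {x n} → 2 ∣ x → ¬ 2 ∣ n → 2 ≤ n →
                          ∃[ u ] ¬ 2 ∣ u × 1 + (1 + x) ^ n + x ^ n ≡ 2 + x * u
  1+[1+x]^n+x^n≡2+x*odd {x} {n@(suc m@(suc m′))} 2∣x odd (s≤s (s≤s _)) with [1+x]^n≡1+x*[n+x*k] x n
  ... | k , eq = x * k + x ^ m + n , u-odd , (begin
    1 + (1 + x) ^ n + x * x ^ m              ≡⟨ cong (λ y → 1 + y + x * x ^ m) eq ⟩
    1 + (1 + x * (n + x * k)) + x * x ^ m    ≡⟨ regroup x n k (x ^ m) ⟩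
    2 + x * (x * k + x ^ m + n)              ∎)
    where
    open ≡-Reasoning
    regroup : ∀ x n k y → 1 + (1 + x * (n + x * k)) + x * y ≡ 2 + x * (x * k + y + n)
    regroup = solve-∀
    u-odd : ¬ 2 ∣ x * k + x ^ m + n
    u-odd 2∣u = odd (∣m+n∣m⇒∣n 2∣u (∣m∣n⇒∣m+n (∣m⇒∣m*n k 2∣x) (∣m⇒∣m*n (x ^ m′) 2∣x)))

  2^m*u≡2^n*v⇒m≡n : ∀ {m n u v} → ¬ 2 ∣ u → ¬ 2 ∣ v → 2 ^ m * u ≡ 2 ^ n * v → m ≡ n
  2^m*u≡2^n*v⇒m≡n {zero}  {zero}  _     _     _  = refl
  2^m*u≡2^n*v⇒m≡n {zero}  {suc n} {u} {v} u-odd _ eq =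
    contradiction (subst (2 ∣_) (trans (sym eq) (*-identityˡ u)) (∣m⇒∣m*n v (m∣m*n (2 ^ n)))) u-odd
  2^m*u≡2^n*v⇒m≡n {suc m} {zero}  {u} {v} _ v-odd eq =
    contradiction (subst (2 ∣_) (trans eq (*-identityˡ v)) (∣m⇒∣m*n u (m∣m*n (2 ^ m)))) v-odd
  2^m*u≡2^n*v⇒m≡n {suc m} {suc n} {u} {v} u-odd v-odd eq =
    cong suc (2^m*u≡2^n*v⇒m≡n u-odd v-odd
      (*-cancelˡ-≡ (2 ^ m * u) (2 ^ n * v) 2 (trans (sym (*-assoc 2 (2 ^ m) u)) (trans eq (*-assoc 2 (2 ^ n) v)))))

  doubledValue : ℕ → ℕ → ℕ
  doubledValue a n = 1 + (1 + 2 ^ a) ^ n + (2 ^ a) ^ n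

  doubledValue-injectiveˡ : ∀ {a b m n} → 1 ≤ a → 1 ≤ b → ¬ 2 ∣ m → ¬ 2 ∣ n → 2 ≤ m → 2 ≤ n →
                            doubledValue a m ≡ doubledValue b n → a ≡ b
  doubledValue-injectiveˡ {suc a} {suc b} _ _ m-odd n-odd 2≤m 2≤n eq
    with 1+[1+x]^n+x^n≡2+x*odd (m∣m*n (2 ^ a)) m-odd 2≤m
       | 1+[1+x]^n+x^n≡2+x*odd (m∣m*n (2 ^ b)) n-odd 2≤n
  ... | u , u-odd , eqᵤ | v , v-odd , eqᵥ =
    2^m*u≡2^n*v⇒m≡n u-odd v-odd (+-cancelˡ-≡ 2 _ _ (trans (sym eqᵤ) (trans eq eqᵥ)))

module _ where
  open import Algebra.Bundles using (CommutativeRing)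
  open import Data.List.Base using (List; []; _∷_; map)
  open import Data.Nat.Base as ℕ using (zero; suc)
  open import Function using (id)
  open import Data.Rational.Base using (ℚ; 0ℚ; 1ℚ; ½; _+_; _*_; -_; _-_; _≤_)
  import Data.Rational.Properties as ℚ
  open import Level using (0ℓ)
  open import Relation.Nullary.Decidable using (dec⇒maybe)
  open import Tactic.RingSolver using (solve-∀)
  import Tactic.RingSolver.Core.AlmostCommutativeRing as ACR
  open import Algebra.Properties.CommutativeSemiring.Exp
    (CommutativeRing.commutativeSemiring ℚ.+-*-commutativeRing) using (_^_; ^-assocʳ; ^-distrib-*)
  open import Algebra.Properties.Semiring.Mult
    (CommutativeRing.semiring ℚ.+-*-commutativeRing) using (_×_; ×-homo-+; ×1-homo-*)
  open import Algebra.Properties.Group ℚ.+-0-group using (∙-cancelˡ)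

  ringℚ : ACR.AlmostCommutativeRing 0ℓ 0ℓ
  ringℚ = ACR.fromCommutativeRing ℚ.+-*-commutativeRing (λ x → dec⇒maybe (0ℚ ℚ.≟ x))

  open ≡-Reasoning

  horner : {A : Set} → (A → ℚ) → List A → ℚ → ℚ
  horner φ []       x = 0ℚ
  horner φ (a ∷ as) x = φ a + x * horner φ as x

  module _ {A : Set} {φ : A → ℚ} where

    horner-addL : ∀ {f : A → A → A} → (∀ a b → φ (f a b) ≡ φ a + φ b) →
                  ∀ as bs x → horner φ (addL f as bs) x ≡ horner φ as x + horner φ bs x
    horner-addL φ-+ []       bs       x = sym (ℚ.+-identityˡ _)
    horner-addL φ-+ (a ∷ as) []       x = sym (ℚ.+-identityʳ _)
    horner-addL {f} φ-+ (a ∷ as) (b ∷ bs) x = begin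
      φ (f a b) + x * horner φ (addL f as bs) x             ≡⟨ cong₂ (λ c d → c + x * d) (φ-+ a b) (horner-addL φ-+ as bs x) ⟩
      φ a + φ b + x * (horner φ as x + horner φ bs x)       ≡⟨ interchange (φ a) (φ b) x _ _ ⟩
      (φ a + x * horner φ as x) + (φ b + x * horner φ bs x) ∎
      where
      interchange : ∀ a b x c d → a + b + x * (c + d) ≡ (a + x * c) + (b + x * d)
      interchange = solve-∀ ringℚ

    horner-map : ∀ {g : A → A} c → (∀ a → φ (g a) ≡ c * φ a) →
                 ∀ as x → horner φ (map g as) x ≡ c * horner φ as x
    horner-map c φ-g []       x = sym (ℚ.*-zeroʳ c)
    horner-map {g} c φ-g (a ∷ as) x = begin
      φ (g a) + x * horner φ (map g as) x ≡⟨ cong₂ (λ d e → d + x * e) (φ-g a) (horner-map c φ-g as x) ⟩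
      c * φ a + x * (c * horner φ as x) ≡⟨ factor c (φ a) x _ ⟩
      c * (φ a + x * horner φ as x)     ∎
      where
      factor : ∀ c a x h → c * a + x * (c * h) ≡ c * (a + x * h)
      factor = solve-∀ ringℚ

    horner-mulL : ∀ {z : A} {add mul : A → A → A} → φ z ≡ 0ℚ →
                  (∀ a b → φ (add a b) ≡ φ a + φ b) → (∀ a b → φ (mul a b) ≡ φ a * φ b) →
                  ∀ as bs x → horner φ (mulL z add mul as bs) x ≡ horner φ as x * horner φ bs x
    horner-mulL φ-z φ-+ φ-* []       bs x = sym (ℚ.*-zeroˡ (horner φ bs x))
    horner-mulL {z} {add} {mul} φ-z φ-+ φ-* (a ∷ as) bs x = begin
      horner φ (addL add (map (mul a) bs) (z ∷ mulL z add mul as bs)) x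
        ≡⟨ horner-addL φ-+ (map (mul a) bs) _ x ⟩
      horner φ (map (mul a) bs) x + (φ z + x * horner φ (mulL z add mul as bs) x)
        ≡⟨ cong₂ (λ c e → c + (φ z + x * e)) (horner-map (φ a) (φ-* a) bs x) (horner-mulL φ-z φ-+ φ-* as bs x) ⟩
      φ a * horner φ bs x + (φ z + x * (horner φ as x * horner φ bs x))
        ≡⟨ cong (λ d → φ a * horner φ bs x + (d + x * (horner φ as x * horner φ bs x))) φ-z ⟩
      φ a * horner φ bs x + (0ℚ + x * (horner φ as x * horner φ bs x))
        ≡⟨ distrib (φ a) x _ _ ⟩
      (φ a + x * horner φ as x) * horner φ bs x ∎
      where
      distrib : ∀ a x h k → a * k + (0ℚ + x * (h * k)) ≡ (a + x * h) * k
      distrib = solve-∀ ringℚ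

  eval1 : P1 → ℚ → ℚ
  eval1 = horner id

  eval2 : P2 → ℚ → ℚ → ℚ
  eval2 a v w = horner (λ c → eval1 c w) a v

  eval1-add1 : ∀ a b w → eval1 (add1 a b) w ≡ eval1 a w + eval1 b w
  eval1-add1 = horner-addL (λ _ _ → refl)

  eval1-scale : ∀ c a w → eval1 (map (c *_) a) w ≡ c * eval1 a w
  eval1-scale c = horner-map c (λ _ → refl)

  eval1-mul1 : ∀ a b w → eval1 (mul1 a b) w ≡ eval1 a w * eval1 b w
  eval1-mul1 = horner-mulL refl (λ _ _ → refl) (λ _ _ → refl)

  module _ (v w : ℚ) where

    eval2-add2 : ∀ a b → eval2 (add2 a b) v w ≡ eval2 a v w + eval2 b v w
    eval2-add2 a b = horner-addL (λ c d → eval1-add1 c d w) a b v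

    eval2-scale2 : ∀ c a → eval2 (scale2 c a) v w ≡ c * eval2 a v w
    eval2-scale2 c a = horner-map c (λ d → eval1-scale c d w) a v

    eval2-sub2 : ∀ a b → eval2 (sub2 a b) v w ≡ eval2 a v w - eval2 b v w
    eval2-sub2 a b = begin
      eval2 (add2 a (neg2 b)) v w        ≡⟨ eval2-add2 a (neg2 b) ⟩
      eval2 a v w + eval2 (neg2 b) v w   ≡⟨ cong (eval2 a v w +_) (eval2-scale2 (- 1ℚ) b) ⟩
      eval2 a v w + - 1ℚ * eval2 b v w   ≡⟨ subtraction (eval2 a v w) (eval2 b v w) ⟩
      eval2 a v w - eval2 b v w          ∎
      where
      subtraction : ∀ x y → x + - 1ℚ * y ≡ x - y
      subtraction = solve-∀ ringℚ

    eval2-mul2 : ∀ a b → eval2 (mul2 a b) v w ≡ eval2 a v w * eval2 b v w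
    eval2-mul2 a b = horner-mulL refl (λ c d → eval1-add1 c d w) (λ c d → eval1-mul1 c d w) a b v

    eval2-pow2 : ∀ a n → eval2 (pow2 a n) v w ≡ eval2 a v w ^ n
    eval2-pow2 a zero    = const-one v w
      where
      const-one : ∀ v w → 1ℚ + w * 0ℚ + v * 0ℚ ≡ 1ℚ
      const-one = solve-∀ ringℚ
    eval2-pow2 a (suc n) = trans (eval2-mul2 a (pow2 a n)) (cong (eval2 a v w *_) (eval2-pow2 a n))

    eval2-varV : eval2 varV v w ≡ v
    eval2-varV = lemma v w
      where
      lemma : ∀ v w → 0ℚ + v * (1ℚ + w * 0ℚ + v * 0ℚ) ≡ v
      lemma = solve-∀ ringℚ

    eval2-varW : eval2 varW v w ≡ w
    eval2-varW = lemma v w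
      where
      lemma : ∀ v w → 0ℚ + w * (1ℚ + w * 0ℚ) + v * 0ℚ ≡ w
      lemma = solve-∀ ringℚ

  fpℚ : Sign → ℕ → ℚ → ℚ → ℚ
  fpℚ s p a b = ½ * (ε s * (ε s * a + b) ^ p + (a ^ p - ε s * b ^ p))

  gppℚ : Sign → ℕ → ℕ → ℚ → ℚ → ℚ
  gppℚ s p p′ v w = fpℚ s p′ (fpℚ s p v w) (fpℚ s p w v) - fpℚ s p (fpℚ s p′ v w) (fpℚ s p′ w v)

  module _ (v w : ℚ) where

    eval2-fp : ∀ s p a b → eval2 (fp s p a b) v w ≡ fpℚ s p (eval2 a v w) (eval2 b v w)
    eval2-fp s p a b = begin
      eval2 (scale2 ½ (add2 first second)) v w                ≡⟨ eval2-scale2 v w ½ (add2 first second) ⟩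
      ½ * eval2 (add2 first second) v w                        ≡⟨ cong (½ *_) (eval2-add2 v w first second) ⟩
      ½ * (eval2 first v w + eval2 second v w)                 ≡⟨ cong₂ (λ x y → ½ * (x + y)) eval-first eval-second ⟩
      ½ * (e * (e * A + B) ^ p + (A ^ p - e * B ^ p))          ∎
      where
      e = ε s
      A = eval2 a v w
      B = eval2 b v w
      first = scale2 e (pow2 (add2 (scale2 e a) b) p)
      second = sub2 (pow2 a p) (scale2 e (pow2 b p))
      eval-first : eval2 first v w ≡ e * (e * A + B) ^ p
      eval-first = begin
        eval2 first v w                                 ≡⟨ eval2-scale2 v w e (pow2 (add2 (scale2 e a) b) p) ⟩
        e * eval2 (pow2 (add2 (scale2 e a) b) p) v w    ≡⟨ cong (e *_) (eval2-pow2 v w (add2 (scale2 e a) b) p) ⟩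
        e * eval2 (add2 (scale2 e a) b) v w ^ p         ≡⟨ cong (λ x → e * x ^ p) (eval2-add2 v w (scale2 e a) b) ⟩
        e * (eval2 (scale2 e a) v w + B) ^ p            ≡⟨ cong (λ x → e * (x + B) ^ p) (eval2-scale2 v w e a) ⟩
        e * (e * A + B) ^ p                             ∎
      eval-second : eval2 second v w ≡ A ^ p - e * B ^ p
      eval-second = begin
        eval2 second v w                                        ≡⟨ eval2-sub2 v w (pow2 a p) (scale2 e (pow2 b p)) ⟩
        eval2 (pow2 a p) v w - eval2 (scale2 e (pow2 b p)) v w  ≡⟨ cong₂ _-_ (eval2-pow2 v w a p) (eval2-scale2 v w e (pow2 b p)) ⟩
        A ^ p - e * eval2 (pow2 b p) v w                        ≡⟨ cong (λ x → A ^ p - e * x) (eval2-pow2 v w b p) ⟩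
        A ^ p - e * B ^ p                                       ∎

    eval2-fpp : ∀ s p p′ → eval2 (fpp s p p′) v w ≡ fpℚ s p′ (fpℚ s p v w) (fpℚ s p w v)
    eval2-fpp s p p′ = begin
      eval2 (fp s p′ (fp s p varV varW) (fp s p varW varV)) v w
        ≡⟨ eval2-fp s p′ (fp s p varV varW) (fp s p varW varV) ⟩
      fpℚ s p′ (eval2 (fp s p varV varW) v w) (eval2 (fp s p varW varV) v w)
        ≡⟨ cong₂ (fpℚ s p′) (eval2-fp s p varV varW) (eval2-fp s p varW varV) ⟩
      fpℚ s p′ (fpℚ s p (eval2 varV v w) (eval2 varW v w)) (fpℚ s p (eval2 varW v w) (eval2 varV v w))
        ≡⟨ cong₂ (λ x y → fpℚ s p′ (fpℚ s p x y) (fpℚ s p y x)) (eval2-varV v w) (eval2-varW v w) ⟩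
      fpℚ s p′ (fpℚ s p v w) (fpℚ s p w v) ∎

    eval2-gpp : ∀ s p p′ → eval2 (gpp s p p′) v w ≡ gppℚ s p p′ v w
    eval2-gpp s p p′ = trans (eval2-sub2 v w (fpp s p p′) (fpp s p′ p)) (cong₂ _-_ (eval2-fpp s p p′) (eval2-fpp s p′ p))

  0ℚ+x*0ℚ≡0ℚ : ∀ x → 0ℚ + x * 0ℚ ≡ 0ℚ
  0ℚ+x*0ℚ≡0ℚ x = trans (ℚ.+-identityˡ (x * 0ℚ)) (ℚ.*-zeroʳ x)

  eval1-zero : ∀ a → (∀ j → coeff1 a j ≡ 0ℚ) → ∀ w → eval1 a w ≡ 0ℚ
  eval1-zero []       _      w = refl
  eval1-zero (c ∷ cs) a≡0 w = begin
    c + w * eval1 cs w ≡⟨ cong₂ (λ x y → x + w * y) (a≡0 0) (eval1-zero cs (a≡0 ∘ suc) w) ⟩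
    0ℚ + w * 0ℚ        ≡⟨ 0ℚ+x*0ℚ≡0ℚ w ⟩
    0ℚ                 ∎

  eval2-zero : ∀ a → IsZero2 a → ∀ v w → eval2 a v w ≡ 0ℚ
  eval2-zero []       _    v w = refl
  eval2-zero (c ∷ cs) a≡0 v w = begin
    eval1 c w + v * eval2 cs v w ≡⟨ cong₂ (λ x y → x + v * y) (eval1-zero c (a≡0 0) w) (eval2-zero cs (a≡0 ∘ suc) v w) ⟩
    0ℚ + v * 0ℚ                  ≡⟨ 0ℚ+x*0ℚ≡0ℚ v ⟩
    0ℚ                           ∎

  x^[2k]≡[x*x]^k : ∀ x k → x ^ (2 ℕ.* k) ≡ (x * x) ^ k
  x^[2k]≡[x*x]^k x k = begin
    x ^ (2 ℕ.* k)       ≡⟨ ^-assocʳ x 2 k ⟨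
    (x * (x * 1ℚ)) ^ k  ≡⟨ cong (λ y → (x * y) ^ k) (ℚ.*-identityʳ x) ⟩
    (x * x) ^ k         ∎

  1^n≡1 : ∀ n → 1ℚ ^ n ≡ 1ℚ
  1^n≡1 zero    = refl
  1^n≡1 (suc n) = trans (ℚ.*-identityˡ (1ℚ ^ n)) (1^n≡1 n)

  x*x≡1⇒x^odd≡x : ∀ {x} k → x * x ≡ 1ℚ → x ^ suc (2 ℕ.* k) ≡ x
  x*x≡1⇒x^odd≡x {x} k x*x≡1 = begin
    x * x ^ (2 ℕ.* k)  ≡⟨ cong (x *_) (x^[2k]≡[x*x]^k x k) ⟩
    x * (x * x) ^ k    ≡⟨ cong (λ y → x * y ^ k) x*x≡1 ⟩
    x * 1ℚ ^ k         ≡⟨ cong (x *_) (1^n≡1 k) ⟩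
    x * 1ℚ             ≡⟨ ℚ.*-identityʳ x ⟩
    x                  ∎

  [-x]^odd≡-x^odd : ∀ x k → (- x) ^ suc (2 ℕ.* k) ≡ - x ^ suc (2 ℕ.* k)
  [-x]^odd≡-x^odd x k = begin
    - x * (- x) ^ (2 ℕ.* k)  ≡⟨ cong (- x *_) (x^[2k]≡[x*x]^k (- x) k) ⟩
    - x * (- x * - x) ^ k    ≡⟨ cong (λ y → - x * y ^ k) (neg*neg x) ⟩
    - x * (x * x) ^ k        ≡⟨ cong (- x *_) (x^[2k]≡[x*x]^k x k) ⟨
    - x * x ^ (2 ℕ.* k)      ≡⟨ ℚ.neg-distribˡ-* x (x ^ (2 ℕ.* k)) ⟨
    - (x * x ^ (2 ℕ.* k))    ∎
    where
    neg*neg : ∀ x → - x * - x ≡ x * x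
    neg*neg = solve-∀ ringℚ

  ε*ε≡1 : ∀ s → ε s * ε s ≡ 1ℚ
  ε*ε≡1 Sign.+ = refl
  ε*ε≡1 Sign.- = refl

  ε^odd≡ε : ∀ s k → ε s ^ suc (2 ℕ.* k) ≡ ε s
  ε^odd≡ε s k = x*x≡1⇒x^odd≡x k (ε*ε≡1 s)

  [-ε]^odd≡-ε : ∀ s k → (- ε s) ^ suc (2 ℕ.* k) ≡ - ε s
  [-ε]^odd≡-ε s k = trans ([-x]^odd≡-x^odd (ε s) k) (cong -_ (ε^odd≡ε s k))

  two : ℚ
  two = 1ℚ + 1ℚ

  module _ (s : Sign) (k : ℕ) where

    private
      e = ε s
      p = suc (2 ℕ.* k)
      X = two ^ (2 ℕ.* k)

    fpℚ-at-2,-ε : fpℚ s p two (- e) ≡ 1ℚ + X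
    fpℚ-at-2,-ε = begin
      ½ * (e * (e * two + - e) ^ p + (two ^ p - e * (- e) ^ p))
        ≡⟨ cong₂ (λ y z → ½ * (e * y + (two ^ p - e * z))) base ([-ε]^odd≡-ε s k) ⟩
      ½ * (e * e + (two * X - e * - e))  ≡⟨ simplify e X ⟩
      e * e + X                          ≡⟨ cong (_+ X) (ε*ε≡1 s) ⟩
      1ℚ + X                             ∎
      where
      linear : ∀ e → e * two + - e ≡ e
      linear = solve-∀ ringℚ
      base : (e * two + - e) ^ p ≡ e
      base = trans (cong (_^ p) (linear e)) (ε^odd≡ε s k)
      simplify : ∀ e X → ½ * (e * e + (two * X - e * - e)) ≡ e * e + X
      simplify = solve-∀ ringℚ

    fpℚ-at-[-ε],2 : fpℚ s p (- e) two ≡ - e * X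
    fpℚ-at-[-ε],2 = begin
      ½ * (e * (e * - e + two) ^ p + ((- e) ^ p - e * two ^ p))
        ≡⟨ cong₂ (λ y z → ½ * (e * y + (z - e * two ^ p))) base ([-ε]^odd≡-ε s k) ⟩
      ½ * (e * 1ℚ + (- e - e * (two * X)))  ≡⟨ simplify e X ⟩
      - e * X                               ∎
      where
      linear : ∀ e → e * - e + two ≡ two - e * e
      linear = solve-∀ ringℚ
      base : (e * - e + two) ^ p ≡ 1ℚ
      base = trans (cong (_^ p) (trans (linear e) (cong (λ y → two - y) (ε*ε≡1 s)))) (1^n≡1 p)
      simplify : ∀ e X → ½ * (e * 1ℚ + (- e - e * (two * X))) ≡ - e * X
      simplify = solve-∀ ringℚ

    fpℚ-at-1+Y,-εY : ∀ Y → fpℚ s p (1ℚ + Y) (- e * Y) ≡ ½ * (1ℚ + (1ℚ + Y) ^ p + Y ^ p)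
    fpℚ-at-1+Y,-εY Y = begin
      ½ * (e * (e * (1ℚ + Y) + - e * Y) ^ p + ((1ℚ + Y) ^ p - e * (- e * Y) ^ p))
        ≡⟨ cong₂ (λ y z → ½ * (e * y + ((1ℚ + Y) ^ p - e * z))) base power ⟩
      ½ * (e * e + ((1ℚ + Y) ^ p - e * (- e * Y ^ p)))  ≡⟨ regroup e ((1ℚ + Y) ^ p) (Y ^ p) ⟩
      ½ * (e * e * (1ℚ + Y ^ p) + (1ℚ + Y) ^ p)         ≡⟨ cong (λ y → ½ * (y * (1ℚ + Y ^ p) + (1ℚ + Y) ^ p)) (ε*ε≡1 s) ⟩
      ½ * (1ℚ * (1ℚ + Y ^ p) + (1ℚ + Y) ^ p)            ≡⟨ simplify ((1ℚ + Y) ^ p) (Y ^ p) ⟩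
      ½ * (1ℚ + (1ℚ + Y) ^ p + Y ^ p)                   ∎
      where
      linear : ∀ e Y → e * (1ℚ + Y) + - e * Y ≡ e
      linear = solve-∀ ringℚ
      base : (e * (1ℚ + Y) + - e * Y) ^ p ≡ e
      base = trans (cong (_^ p) (linear e Y)) (ε^odd≡ε s k)
      power : (- e * Y) ^ p ≡ - e * Y ^ p
      power = trans (^-distrib-* (- e) Y p) (cong (_* Y ^ p) ([-ε]^odd≡-ε s k))
      regroup : ∀ e A B → ½ * (e * e + (A - e * (- e * B))) ≡ ½ * (e * e * (1ℚ + B) + A)
      regroup = solve-∀ ringℚ
      simplify : ∀ A B → ½ * (1ℚ * (1ℚ + B) + A) ≡ ½ * (1ℚ + A + B)
      simplify = solve-∀ ringℚ

  fromℕ : ℕ → ℚ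
  fromℕ n = n × 1ℚ

  fromℕ-^ : ∀ m n → fromℕ (m ℕ.^ n) ≡ fromℕ m ^ n
  fromℕ-^ m zero    = refl
  fromℕ-^ m (suc n) = trans (×1-homo-* m (m ℕ.^ n)) (cong (fromℕ m *_) (fromℕ-^ m n))

  fromℕ-doubledValue : ∀ a n → fromℕ (doubledValue a n) ≡ 1ℚ + (1ℚ + two ^ a) ^ n + (two ^ a) ^ n
  fromℕ-doubledValue a n = begin
    fromℕ (1 ℕ.+ (1 ℕ.+ 2 ℕ.^ a) ℕ.^ n ℕ.+ (2 ℕ.^ a) ℕ.^ n)
      ≡⟨ ×-homo-+ 1ℚ (1 ℕ.+ (1 ℕ.+ 2 ℕ.^ a) ℕ.^ n) ((2 ℕ.^ a) ℕ.^ n) ⟩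
    1ℚ + fromℕ ((1 ℕ.+ 2 ℕ.^ a) ℕ.^ n) + fromℕ ((2 ℕ.^ a) ℕ.^ n)
      ≡⟨ cong₂ (λ x y → 1ℚ + x + y) (fromℕ-^ (1 ℕ.+ 2 ℕ.^ a) n) (fromℕ-^ (2 ℕ.^ a) n) ⟩
    1ℚ + (1ℚ + fromℕ (2 ℕ.^ a)) ^ n + fromℕ (2 ℕ.^ a) ^ n
      ≡⟨ cong (λ x → 1ℚ + (1ℚ + x) ^ n + x ^ n) (fromℕ-^ 2 a) ⟩
    1ℚ + (1ℚ + two ^ a) ^ n + (two ^ a) ^ n ∎

  0≤fromℕ : ∀ n → 0ℚ ≤ fromℕ n
  0≤fromℕ zero    = ℚ.≤-refl
  0≤fromℕ (suc n) = ℚ.+-mono-≤ (ℚ.<⇒≤ (ℚ.positive⁻¹ 1ℚ)) (0≤fromℕ n)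

  fromℕ-suc≢0 : ∀ n → fromℕ (suc n) ≢ 0ℚ
  fromℕ-suc≢0 n = ℚ.<⇒≢ (ℚ.+-mono-<-≤ (ℚ.positive⁻¹ 1ℚ) (0≤fromℕ n)) ∘ sym

  fromℕ-injective : ∀ {m n} → fromℕ m ≡ fromℕ n → m ≡ n
  fromℕ-injective {zero}  {zero}  _  = refl
  fromℕ-injective {zero}  {suc n} eq = contradiction (sym eq) (fromℕ-suc≢0 n)
  fromℕ-injective {suc m} {zero}  eq = contradiction eq (fromℕ-suc≢0 m)
  fromℕ-injective {suc m} {suc n} eq = cong suc (fromℕ-injective (∙-cancelˡ 1ℚ (fromℕ m) (fromℕ n) eq))

  gppℚ-at-2,-ε : ∀ s k k′ →
    gppℚ s (suc (2 ℕ.* k)) (suc (2 ℕ.* k′)) two (- ε s)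
      ≡ ½ * fromℕ (doubledValue (2 ℕ.* k) (suc (2 ℕ.* k′))) - ½ * fromℕ (doubledValue (2 ℕ.* k′) (suc (2 ℕ.* k)))
  gppℚ-at-2,-ε s k k′ = cong₂ _-_ (fpp-value k k′) (fpp-value k′ k)
    where
    fpp-value : ∀ k k′ → let p = suc (2 ℕ.* k); p′ = suc (2 ℕ.* k′) in
      fpℚ s p′ (fpℚ s p two (- ε s)) (fpℚ s p (- ε s) two) ≡ ½ * fromℕ (doubledValue (2 ℕ.* k) p′)
    fpp-value k k′ = begin
      fpℚ s p′ (fpℚ s p two (- ε s)) (fpℚ s p (- ε s) two)  ≡⟨ cong₂ (fpℚ s p′) (fpℚ-at-2,-ε s k) (fpℚ-at-[-ε],2 s k) ⟩
      fpℚ s p′ (1ℚ + X) (- ε s * X)                         ≡⟨ fpℚ-at-1+Y,-εY s k′ X ⟩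
      ½ * (1ℚ + (1ℚ + X) ^ p′ + X ^ p′)                     ≡⟨ cong (½ *_) (fromℕ-doubledValue (2 ℕ.* k) p′) ⟨
      ½ * fromℕ (doubledValue (2 ℕ.* k) p′)                 ∎
      where
      p = suc (2 ℕ.* k)
      p′ = suc (2 ℕ.* k′)
      X = two ^ (2 ℕ.* k)

  ½*x-½*y≡0⇒x≡y : ∀ {x y} → ½ * x - ½ * y ≡ 0ℚ → x ≡ y
  ½*x-½*y≡0⇒x≡y {x} {y} eq = begin
    x                          ≡⟨ double x y ⟩
    two * (½ * x - ½ * y) + y  ≡⟨ cong (λ z → two * z + y) eq ⟩
    two * 0ℚ + y               ≡⟨ cancel y ⟩
    y                          ∎
    where
    double : ∀ x y → x ≡ two * (½ * x - ½ * y) + y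
    double = solve-∀ ringℚ
    cancel : ∀ y → two * 0ℚ + y ≡ y
    cancel = solve-∀ ringℚ

  IsZero2-gpp⇒doubledValue≡ : ∀ s k k′ → IsZero2 (gpp s (suc (2 ℕ.* k)) (suc (2 ℕ.* k′))) →
    doubledValue (2 ℕ.* k) (suc (2 ℕ.* k′)) ≡ doubledValue (2 ℕ.* k′) (suc (2 ℕ.* k))
  IsZero2-gpp⇒doubledValue≡ s k k′ g≡0 = fromℕ-injective (½*x-½*y≡0⇒x≡y (begin
    ½ * fromℕ (doubledValue (2 ℕ.* k) p′) - ½ * fromℕ (doubledValue (2 ℕ.* k′) p) ≡⟨ gppℚ-at-2,-ε s k k′ ⟨
    gppℚ s p p′ two (- ε s)                                                      ≡⟨ eval2-gpp two (- ε s) s p p′ ⟨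
    eval2 (gpp s p p′) two (- ε s)                                               ≡⟨ eval2-zero (gpp s p p′) g≡0 two (- ε s) ⟩
    0ℚ                                                                           ∎))
    where
    p = suc (2 ℕ.* k)
    p′ = suc (2 ℕ.* k′)

lemma4p1 : (s : Sign) (p p′ : ℕ) → Prime p → Prime p′ → ¬ (2 ∣ p) → ¬ (2 ∣ p′) → p ≢ p′
             → ¬ IsZero2 (gpp s p p′)
lemma4p1 s p p′ p-prime p′-prime p-odd p′-odd p≢p′ g≡0
  with odd-prime⇒≡3+2k p-prime p-odd | odd-prime⇒≡3+2k p′-prime p′-odd
... | k , refl | k′ , refl =
  p≢p′ (cong suc (doubledValue-injectiveˡ (s≤s z≤n) (s≤s z≤n) p′-odd p-odd (s≤s (s≤s z≤n)) (s≤s (s≤s z≤n))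
    (IsZero2-gpp⇒doubledValue≡ s (suc k) (suc k′) g≡0)))
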